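{- Let $M$ be a matroid on $[n]$ with rank function $r$. Let $K\subseteq[n]$ and $i\neq j\in[n]\setminus K$. Then $r(iK)+r(jK)\neq r(ijK)+r(K)$ if and only if there exists a circuit $C$ of $M$ with $\{i,j\}\subseteq C\subseteq ijK$ and every circuit of $M$ contained in $ijK$ contains either both $i$ and $j$ or neither of them.
   Context: Notation: $iK=\{i\}\cup K$, $ijK=\{i,j\}\cup K$ (disjoint unions). In the paper's language, $r(iK)+r(jK)\neq r(ijK)+r(K)$ is written $i\not\perp j\,|\,K$ (conditional dependence in the CI-structure of $M$). -}

module Defs where

open import Data.Nat using (ℕ; _+_; _≤_; _<_)
open import Data.Fin using (Fin)
open import Data.Fin.Subset using (Subset; ⊥; _∪_; _∩_; _⊆_; _⊂_; ∣_∣)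
open import Data.Product using (_×_)
open import Relation.Nullary using (¬_)

-- A matroid on the ground set [n] = Fin n, given by its rank function
-- (rank axioms R1–R3, with r(∅) = 0 implied by R1).
record Matroid (n : ℕ) : Set where
  field
    r         : Subset n → ℕ
    r-bounded : ∀ X → r X ≤ ∣ X ∣
    r-mono    : ∀ {X Y} → X ⊆ Y → r X ≤ r Y
    r-submod  : ∀ X Y → r (X ∪ Y) + r (X ∩ Y) ≤ r X + r Y

open Matroid public

Dependent : ∀ {n} → Matroid n → Subset n → Set
Dependent M X = r M X < ∣ X ∣

Circuit : ∀ {n} → Matroid n → Subset n → Set
Circuit M C = Dependent M C × (∀ D → D ⊂ C → ¬ Dependent M D)

-- Write e ∈ cl(X) for r(X ∪ e) = r(X). A circuit through e inside X ∪ e is exactly a witness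
-- of e ∈ cl(X) (for e ∉ X). Submodularity together with r(X ∪ e) ≤ r(X) + 1 leaves only one way
-- for r(iK) + r(jK) ≠ r(ijK) + r(K): neither i nor j lies in cl(K), but j ∈ cl(iK). A circuit
-- through j in ijK must then contain i as well, and a circuit in ijK meeting {i, j} in one element
-- would put i or j into cl(K).
module Submission where

open import Defs
open import Data.Nat using (ℕ; suc; _+_; _≤_; _<_; s≤s; _≤?_; _<?_)
open import Data.Nat.Properties hiding (_≟_)
open import Data.Nat.Induction using (<-wellFounded)
open import Data.Vec using (_∷_; here; there)
open import Data.Fin using (Fin; _≟_)
open import Data.Fin.Subset
open import Data.Fin.Subset.Properties
open import Data.Product using (_×_; _,_; ∃-syntax)
open import Data.Sum using (_⊎_; inj₁; inj₂; [_,_]′)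
open import Data.Empty using (⊥-elim)
open import Function using (_∘_)
open import Function.Bundles using (_⇔_; mk⇔)
open import Function.Construct.Composition using (_⇔-∘_)
open import Induction.WellFounded using (Acc; acc)
open import Relation.Nullary using (¬_; yes; no; contradiction)
open import Relation.Nullary.Decidable using (_×-dec_)
open import Relation.Unary using (Decidable)
open import Relation.Binary.PropositionalEquality

∣p∣≡1+∣p-x∣ : ∀ {n} {x : Fin n} {p : Subset n} → x ∈ p → ∣ p ∣ ≡ suc ∣ p - x ∣
∣p∣≡1+∣p-x∣ {p = inside ∷ p}  here        = cong (suc ∘ ∣_∣) (sym (p─⊥≡p p))
∣p∣≡1+∣p-x∣ {p = inside ∷ p}  (there x∈p) = cong suc (∣p∣≡1+∣p-x∣ x∈p)
∣p∣≡1+∣p-x∣ {p = outside ∷ p} (there x∈p) = ∣p∣≡1+∣p-x∣ x∈p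

x∈p─q⇒x∉q : ∀ {n} {x : Fin n} (p q : Subset n) → x ∈ p ─ q → x ∉ q
x∈p─q⇒x∉q (inside ∷ p) (outside ∷ q) here      ()
x∈p─q⇒x∉q (_ ∷ p)      (_ ∷ q)       (there m) (there m') = x∈p─q⇒x∉q p q m m'

∪-least : ∀ {n} {p q s : Subset n} → p ⊆ s → q ⊆ s → p ∪ q ⊆ s
∪-least {p = p} {q} p⊆s q⊆s = [ p⊆s , q⊆s ]′ ∘ x∈p∪q⁻ p q

∪-monoʳ-⊆ : ∀ {n} {p q q′ : Subset n} → q ⊆ q′ → p ∪ q ⊆ p ∪ q′
∪-monoʳ-⊆ {q′ = q′} q⊆q′ = ∪-least (p⊆p∪q q′) (q⊆p∪q _ q′ ∘ q⊆q′)

x∈p⇒⁅x⁆⊆p : ∀ {n} {x : Fin n} {p : Subset n} → x ∈ p → ⁅ x ⁆ ⊆ p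
x∈p⇒⁅x⁆⊆p {x = x} {p} x∈p y∈⁅x⁆ = subst (_∈ p) (sym (x∈⁅y⁆⇒x≡y x y∈⁅x⁆)) x∈p

x≢y∧x∉q⇒x∉⁅y⁆∪q : ∀ {n} {x y : Fin n} {q : Subset n} → ¬ x ≡ y → x ∉ q → x ∉ ⁅ y ⁆ ∪ q
x≢y∧x∉q⇒x∉⁅y⁆∪q {y = y} {q} x≢y x∉q = [ x≢y ∘ x∈⁅y⁆⇒x≡y y , x∉q ]′ ∘ x∈p∪q⁻ ⁅ y ⁆ q

p⊆⁅x⁆∪[p-x] : ∀ {n} {x : Fin n} {p : Subset n} → p ⊆ ⁅ x ⁆ ∪ (p - x)
p⊆⁅x⁆∪[p-x] {_} {x} {_} {y} y∈p with y ≟ x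
... | yes refl = x∈p∪q⁺ (inj₁ (x∈⁅x⁆ x))
... | no y≢x   = x∈p∪q⁺ (inj₂ (x∈p∧x≢y⇒x∈p-y y∈p y≢x))

p⊆⁅x⁆∪q⇒p-x⊆q : ∀ {n} {x : Fin n} {p q : Subset n} → p ⊆ ⁅ x ⁆ ∪ q → p - x ⊆ q
p⊆⁅x⁆∪q⇒p-x⊆q {x = x} {p} {q} p⊆ y∈p-x with x∈p∪q⁻ ⁅ x ⁆ q (p⊆ (p─q⊆p p ⁅ x ⁆ y∈p-x))
... | inj₁ y∈⁅x⁆ = contradiction y∈⁅x⁆ (x∈p─q⇒x∉q p ⁅ x ⁆ y∈p-x)
... | inj₂ y∈q   = y∈q

p⊆⁅x⁆∪q∧x∉p⇒p⊆q : ∀ {n} {x : Fin n} {p q : Subset n} → p ⊆ ⁅ x ⁆ ∪ q → x ∉ p → p ⊆ q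
p⊆⁅x⁆∪q∧x∉p⇒p⊆q p⊆ x∉p y∈p =
  p⊆⁅x⁆∪q⇒p-x⊆q p⊆ (x∈p∧x≢y⇒x∈p-y y∈p λ { refl → x∉p y∈p })

p∪q∪s≡q∪p∪s : ∀ {n} (p q s : Subset n) → p ∪ q ∪ s ≡ q ∪ p ∪ s
p∪q∪s≡q∪p∪s p q s = begin
  p ∪ q ∪ s    ≡⟨ ∪-assoc p q s ⟨
  (p ∪ q) ∪ s  ≡⟨ cong (_∪ s) (∪-comm p q) ⟩
  (q ∪ p) ∪ s  ≡⟨ ∪-assoc q p s ⟩
  q ∪ p ∪ s    ∎
  where open ≡-Reasoning

⊆-∪-swap : ∀ {n} {t : Subset n} p q s → t ⊆ p ∪ q ∪ s → t ⊆ q ∪ p ∪ s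
⊆-∪-swap {t = t} p q s = subst (t ⊆_) (p∪q∪s≡q∪p∪s p q s)

Minimal : ∀ {n} → (Subset n → Set) → Subset n → Set
Minimal P Z = P Z × (∀ W → W ⊂ Z → ¬ P W)

minimal-⊆ : ∀ {n} {P : Subset n → Set} → Decidable P →
            ∀ {Y} → P Y → ∃[ Z ] (Z ⊆ Y × Minimal P Z)
minimal-⊆ {P = P} P? {Y} = go Y (<-wellFounded ∣ Y ∣)
  where
  go : ∀ Y → Acc _<_ ∣ Y ∣ → P Y → ∃[ Z ] (Z ⊆ Y × Minimal P Z)
  go Y (acc rs) pY with anySubset? (λ W → W ⊂? Y ×-dec P? W)
  ... | yes (W , W⊂Y , pW) =
    let (Z , Z⊆W , Z-min) = go W (rs (p⊂q⇒∣p∣<∣q∣ W⊂Y)) pW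
    in  Z , p⊂q⇒p⊆q W⊂Y ∘ Z⊆W , Z-min
  ... | no ∄W = Y , ⊆-refl , pY , λ W W⊂Y pW → ∄W (W , W⊂Y , pW)

-- k, a, b, u stand for r(K), r(iK), r(jK), r(ijK).
rank-defect-≢⇔ : ∀ {k a b u} → a ≤ suc k → b ≤ suc k → u ≤ suc b → a ≤ u → b ≤ u →
                 u + k ≤ a + b → (¬ a + b ≡ u + k) ⇔ (¬ a ≤ k × ¬ b ≤ k × u ≤ a)
rank-defect-≢⇔ {k} {a} {b} {u} a≤1+k b≤1+k u≤1+b a≤u b≤u submod = mk⇔ to from
  where
  open ≤-Reasoning

  to : ¬ a + b ≡ u + k → ¬ a ≤ k × ¬ b ≤ k × u ≤ a
  to a+b≢u+k = a≰k , b≰k , u≤a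
    where
    a≰k : ¬ a ≤ k
    a≰k a≤k = a+b≢u+k (≤-antisym (subst (a + b ≤_) (+-comm k u) (+-mono-≤ a≤k b≤u)) submod)
    b≰k : ¬ b ≤ k
    b≰k b≤k = a+b≢u+k (≤-antisym (+-mono-≤ a≤u b≤k) submod)
    a≡1+k : a ≡ suc k
    a≡1+k = ≤-antisym a≤1+k (≰⇒> a≰k)
    b≡1+k : b ≡ suc k
    b≡1+k = ≤-antisym b≤1+k (≰⇒> b≰k)
    u≤a : u ≤ a
    u≤a with u ≤? a
    ... | yes u≤a = u≤a
    ... | no u≰a  = contradiction a+b≡u+k a+b≢u+k
      where
      u≡2+k : u ≡ suc (suc k)
      u≡2+k = ≤-antisym (subst (λ m → u ≤ suc m) b≡1+k u≤1+b) (subst (_< u) a≡1+k (≰⇒> u≰a))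
      a+b≡u+k : a + b ≡ u + k
      a+b≡u+k = begin-equality
        a + b              ≡⟨ cong₂ _+_ a≡1+k b≡1+k ⟩
        suc k + suc k      ≡⟨ cong suc (+-suc k k) ⟩
        suc (suc k) + k    ≡⟨ cong (_+ k) u≡2+k ⟨
        u + k              ∎

  from : ¬ a ≤ k × ¬ b ≤ k × u ≤ a → ¬ a + b ≡ u + k
  from (_ , b≰k , u≤a) a+b≡u+k = 1+n≰n (+-cancelˡ-≤ a (suc k) k (begin
    a + suc k  ≡⟨ cong (a +_) (≤-antisym b≤1+k (≰⇒> b≰k)) ⟨
    a + b      ≡⟨ a+b≡u+k ⟩
    u + k      ≤⟨ +-monoˡ-≤ k u≤a ⟩
    a + k      ∎))

module Closure {n : ℕ} (M : Matroid n) where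

  infix 4 _∈cl_ _∉cl_

  -- r(X) ≤ r(X ∪ e) always holds, so this says r(X ∪ e) = r(X).
  _∈cl_ : Fin n → Subset n → Set
  e ∈cl X = r M (⁅ e ⁆ ∪ X) ≤ r M X

  _∉cl_ : Fin n → Subset n → Set
  e ∉cl X = ¬ e ∈cl X

  r-submod-⊆ : ∀ {X Y Z W} → Z ⊆ X ∪ Y → W ⊆ X ∩ Y → r M Z + r M W ≤ r M X + r M Y
  r-submod-⊆ {X} {Y} Z⊆ W⊆ = ≤-trans (+-mono-≤ (r-mono M Z⊆) (r-mono M W⊆)) (r-submod M X Y)

  r-insert≤suc : ∀ e X → r M (⁅ e ⁆ ∪ X) ≤ suc (r M X)
  r-insert≤suc e X = begin
    r M (⁅ e ⁆ ∪ X)                   ≤⟨ m≤m+n _ _ ⟩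
    r M (⁅ e ⁆ ∪ X) + r M (⁅ e ⁆ ∩ X)  ≤⟨ r-submod M ⁅ e ⁆ X ⟩
    r M ⁅ e ⁆ + r M X                 ≤⟨ +-monoˡ-≤ (r M X) (r-bounded M ⁅ e ⁆) ⟩
    ∣ ⁅ e ⁆ ∣ + r M X                 ≡⟨ cong (_+ r M X) (∣⁅x⁆∣≡1 e) ⟩
    suc (r M X)                       ∎
    where open ≤-Reasoning

  dependent⇒nonempty : ∀ {C} → Dependent M C → Nonempty C
  dependent⇒nonempty {C} C-dep with nonempty? C
  ... | yes ne = ne
  ... | no ¬ne = contradiction (subst (r M C <_) ∣C∣≡0 C-dep) λ ()
    where
    ∣C∣≡0 : ∣ C ∣ ≡ 0
    ∣C∣≡0 = trans (cong ∣_∣ (Empty-unique ¬ne)) (∣⊥∣≡0 n)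

  circuit⇒∈cl : ∀ {C e X} → Circuit M C → e ∈ C → C ⊆ ⁅ e ⁆ ∪ X → e ∈cl X
  circuit⇒∈cl {C} {e} {X} (C-dep , C-min) e∈C C⊆ = +-cancelʳ-≤ (r M (C - e)) _ _ (begin
    r M (⁅ e ⁆ ∪ X) + r M (C - e)  ≤⟨ r-submod-⊆ (∪-least (q⊆p∪q X C ∘ x∈p⇒⁅x⁆⊆p e∈C) (p⊆p∪q C)) C-e⊆X∩C ⟩
    r M X + r M C                  ≤⟨ +-monoʳ-≤ (r M X) rC≤rC-e ⟩
    r M X + r M (C - e)            ∎)
    where
    open ≤-Reasoning
    C-e⊆X∩C : C - e ⊆ X ∩ C
    C-e⊆X∩C y∈ = x∈p∩q⁺ (p⊆⁅x⁆∪q⇒p-x⊆q C⊆ y∈ , p─q⊆p C ⁅ e ⁆ y∈)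
    -- C is dependent while C - e is independent, and they differ in size by one.
    rC≤rC-e : r M C ≤ r M (C - e)
    rC≤rC-e = ≤-pred (begin-strict
      r M C              <⟨ C-dep ⟩
      ∣ C ∣              ≡⟨ ∣p∣≡1+∣p-x∣ e∈C ⟩
      suc ∣ C - e ∣      ≤⟨ s≤s (≮⇒≥ (C-min (C - e) (x∈p⇒p-x⊂p e∈C))) ⟩
      suc (r M (C - e))  ∎)

  circuit-element-redundant : ∀ {C Y f} → Circuit M C → C ⊆ Y → f ∈ C → r M Y ≤ r M (Y - f)
  circuit-element-redundant C-circ C⊆Y f∈C =
    ≤-trans (r-mono M p⊆⁅x⁆∪[p-x]) (circuit⇒∈cl C-circ f∈C (p⊆⁅x⁆∪[p-x] ∘ C⊆Y))

  minimal-∈cl⇒circuit : ∀ {e Y} → e ∉ Y → Minimal (e ∈cl_) Y →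
                        ∃[ C ] (Circuit M C × e ∈ C × C ⊆ ⁅ e ⁆ ∪ Y)
  minimal-∈cl⇒circuit {e} {Y} e∉Y (e∈clY , Y-min) =
    through-e (minimal-⊆ (λ Z → r M Z <? ∣ Z ∣) eY-dependent)
    where
    Y⊂eY : Y ⊂ ⁅ e ⁆ ∪ Y
    Y⊂eY = q⊆p∪q ⁅ e ⁆ Y , e , x∈p∪q⁺ (inj₁ (x∈⁅x⁆ e)) , e∉Y
    eY-dependent : Dependent M (⁅ e ⁆ ∪ Y)
    eY-dependent = ≤-trans (s≤s (≤-trans e∈clY (r-bounded M Y))) (p⊂q⇒∣p∣<∣q∣ Y⊂eY)
    e∈cl[Y-f] : ∀ {C f} → Circuit M C → C ⊆ Y → f ∈ C → e ∈cl (Y - f)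
    e∈cl[Y-f] {C} {f} C-circ C⊆Y f∈C = begin
      r M (⁅ e ⁆ ∪ (Y - f))  ≤⟨ r-mono M (∪-monoʳ-⊆ (p─q⊆p Y ⁅ f ⁆)) ⟩
      r M (⁅ e ⁆ ∪ Y)        ≤⟨ e∈clY ⟩
      r M Y                  ≤⟨ circuit-element-redundant C-circ C⊆Y f∈C ⟩
      r M (Y - f)            ∎
      where open ≤-Reasoning
    through-e : ∃[ C ] (C ⊆ ⁅ e ⁆ ∪ Y × Circuit M C) → ∃[ C ] (Circuit M C × e ∈ C × C ⊆ ⁅ e ⁆ ∪ Y)
    through-e (C , C⊆eY , C-circ@(C-dep , _)) with e ∈? C | dependent⇒nonempty C-dep
    ... | yes e∈C | _       = C , C-circ , e∈C , C⊆eY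
    ... | no e∉C  | f , f∈C =
      let C⊆Y = p⊆⁅x⁆∪q∧x∉p⇒p⊆q C⊆eY e∉C
      in  ⊥-elim (Y-min (Y - f) (x∈p⇒p-x⊂p (C⊆Y f∈C)) (e∈cl[Y-f] C-circ C⊆Y f∈C))

  ∈cl⇒circuit : ∀ {e X} → e ∉ X → e ∈cl X → ∃[ C ] (Circuit M C × e ∈ C × C ⊆ ⁅ e ⁆ ∪ X)
  ∈cl⇒circuit {e} {X} e∉X e∈clX with minimal-⊆ (λ Y → r M (⁅ e ⁆ ∪ Y) ≤? r M Y) e∈clX
  ... | Y , Y⊆X , Y-min with minimal-∈cl⇒circuit (e∉X ∘ Y⊆X) Y-min
  ...   | C , C-circ , e∈C , C⊆eY = C , C-circ , e∈C , ∪-monoʳ-⊆ Y⊆X ∘ C⊆eY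

  ci-dependent⇔ : ∀ i j K →
    (¬ (r M (⁅ i ⁆ ∪ K) + r M (⁅ j ⁆ ∪ K) ≡ r M (⁅ i ⁆ ∪ ⁅ j ⁆ ∪ K) + r M K))
    ⇔ (i ∉cl K × j ∉cl K × j ∈cl (⁅ i ⁆ ∪ K))
  ci-dependent⇔ i j K rewrite p∪q∪s≡q∪p∪s ⁅ j ⁆ ⁅ i ⁆ K = rank-defect-≢⇔
    (r-insert≤suc i K)
    (r-insert≤suc j K)
    (r-insert≤suc i (⁅ j ⁆ ∪ K))
    (r-mono M (∪-monoʳ-⊆ (q⊆p∪q ⁅ j ⁆ K)))
    (r-mono M (q⊆p∪q ⁅ i ⁆ _))
    (r-submod-⊆ (∪-least (p⊆p∪q _ ∘ p⊆p∪q K) (q⊆p∪q _ _))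
                (λ y∈K → x∈p∩q⁺ (q⊆p∪q ⁅ i ⁆ K y∈K , q⊆p∪q ⁅ j ⁆ K y∈K)))

  JoiningCircuit : Fin n → Fin n → Subset n → Set
  JoiningCircuit i j K = ∃[ C ] (Circuit M C × i ∈ C × j ∈ C × C ⊆ ⁅ i ⁆ ∪ ⁅ j ⁆ ∪ K)

  NoCircuitSeparates : Fin n → Fin n → Subset n → Set
  NoCircuitSeparates i j K =
    ∀ D → Circuit M D → D ⊆ ⁅ i ⁆ ∪ ⁅ j ⁆ ∪ K → (i ∈ D × j ∈ D) ⊎ (i ∉ D × j ∉ D)

  closure⇒circuits : ∀ {i j K} → ¬ i ≡ j → j ∉ K →
    i ∉cl K × j ∉cl K × j ∈cl (⁅ i ⁆ ∪ K) → JoiningCircuit i j K × NoCircuitSeparates i j K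
  closure⇒circuits {i} {j} {K} i≢j j∉K (i∉clK , j∉clK , j∈cl[iK])
    with ∈cl⇒circuit (x≢y∧x∉q⇒x∉⁅y⁆∪q (i≢j ∘ sym) j∉K) j∈cl[iK]
  ... | C , C-circ , j∈C , C⊆jiK = (C , C-circ , i∈C , j∈C , C⊆ijK) , separates
    where
    C⊆ijK : C ⊆ ⁅ i ⁆ ∪ ⁅ j ⁆ ∪ K
    C⊆ijK = ⊆-∪-swap ⁅ j ⁆ ⁅ i ⁆ K C⊆jiK
    i∈C : i ∈ C
    i∈C with i ∈? C
    ... | yes i∈C = i∈C
    ... | no i∉C  = contradiction (circuit⇒∈cl C-circ j∈C (p⊆⁅x⁆∪q∧x∉p⇒p⊆q C⊆ijK i∉C)) j∉clK
    separates : NoCircuitSeparates i j K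
    separates D D-circ D⊆ijK with i ∈? D | j ∈? D
    ... | yes i∈D | yes j∈D = inj₁ (i∈D , j∈D)
    ... | no i∉D  | no j∉D  = inj₂ (i∉D , j∉D)
    ... | yes i∈D | no j∉D  = contradiction
      (circuit⇒∈cl D-circ i∈D (p⊆⁅x⁆∪q∧x∉p⇒p⊆q (⊆-∪-swap ⁅ i ⁆ ⁅ j ⁆ K D⊆ijK) j∉D)) i∉clK
    ... | no i∉D  | yes j∈D = contradiction
      (circuit⇒∈cl D-circ j∈D (p⊆⁅x⁆∪q∧x∉p⇒p⊆q D⊆ijK i∉D)) j∉clK

  circuits⇒closure : ∀ {i j K} → ¬ i ≡ j → i ∉ K → j ∉ K →
    JoiningCircuit i j K × NoCircuitSeparates i j K → i ∉cl K × j ∉cl K × j ∈cl (⁅ i ⁆ ∪ K)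
  circuits⇒closure {i} {j} {K} i≢j i∉K j∉K ((C , C-circ , _ , j∈C , C⊆ijK) , separates) =
    i∉clK , j∉clK , circuit⇒∈cl C-circ j∈C (⊆-∪-swap ⁅ i ⁆ ⁅ j ⁆ K C⊆ijK)
    where
    i∉clK : i ∉cl K
    i∉clK i∈clK with ∈cl⇒circuit i∉K i∈clK
    ... | D , D-circ , i∈D , D⊆iK with separates D D-circ (∪-monoʳ-⊆ (q⊆p∪q ⁅ j ⁆ K) ∘ D⊆iK)
    ...   | inj₁ (_ , j∈D) = x≢y∧x∉q⇒x∉⁅y⁆∪q (i≢j ∘ sym) j∉K (D⊆iK j∈D)
    ...   | inj₂ (i∉D , _) = i∉D i∈D
    j∉clK : j ∉cl K
    j∉clK j∈clK with ∈cl⇒circuit j∉K j∈clK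
    ... | D , D-circ , j∈D , D⊆jK with separates D D-circ (q⊆p∪q ⁅ i ⁆ _ ∘ D⊆jK)
    ...   | inj₁ (i∈D , _) = x≢y∧x∉q⇒x∉⁅y⁆∪q i≢j i∉K (D⊆jK i∈D)
    ...   | inj₂ (_ , j∉D) = j∉D j∈D

lemma2p2 : ∀ {n} (M : Matroid n) (K : Subset n) (i j : Fin n) →
    ¬ (i ≡ j) → i ∉ K → j ∉ K →
    (¬ (r M (⁅ i ⁆ ∪ K) + r M (⁅ j ⁆ ∪ K) ≡ r M (⁅ i ⁆ ∪ ⁅ j ⁆ ∪ K) + r M K))
    ⇔
    ((∃[ C ] (Circuit M C × i ∈ C × j ∈ C × C ⊆ ⁅ i ⁆ ∪ ⁅ j ⁆ ∪ K))
     × (∀ D → Circuit M D → D ⊆ ⁅ i ⁆ ∪ ⁅ j ⁆ ∪ K →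
          (i ∈ D × j ∈ D) ⊎ (i ∉ D × j ∉ D)))
lemma2p2 M K i j i≢j i∉K j∉K =
  mk⇔ (closure⇒circuits i≢j j∉K) (circuits⇒closure i≢j i∉K j∉K) ⇔-∘ ci-dependent⇔ i j K
  where open Closure M
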